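{- If there exists $u\in A^*\setminus A$ such that the set of vertices $u$ is helpful for equals $\{n(u)\}$ and $n(u)\in A'$, then $\{u,t(n(u))\}$ is a local improvement of $A$.
   Context: Let $k\geq 4$ be an integer and $G=(V,E)$ a finite simple $(k+1)$-claw free graph (no vertex has $k+1$ pairwise non-adjacent neighbors) with weights $w:V\to\mathbb{Q}_{>0}$; $w(X)=\sum_{x\in X}w(x)$, $w^2(X)=\sum_{x\in X}w(x)^2$. Let $A^*$ be a maximum-weight independent set and $A$ an independent set. $N(X,A)=(X\cap A)\cup\{a\in A: a\text{ adjacent to some }x\in X\}$, $N(u,A)=N(\{u\},A)$. An independent $X$ is a local improvement of $A$ if $w^2(X)>w^2(N(X,A))$; it is claw-shaped if $|X|=1$ and $N(X,A)=\emptyset$, or some $v\in A$ is adjacent to all of $X$. Assume no claw-shaped improvement of $A$ exists. Fix $n(u)\in N(u,A)$ of maximum weight and, if $|N(u,A)|\geq2$, $n_2(u)\in N(u,A)\setminus\{n(u)\}$ of maximum weight. $\mathrm{contr}(u,v)=\max\{0,(w(u)^2-w^2(N(u,A)\setminus\{v\}))/w(v)\}$ if $v\in N(u,A)$, else $0$. The constant $\epsilon>0$ satisfies $\frac38(1+\epsilon)^2+\epsilon^2\leq\frac{11}{16}(1+\epsilon)^2+\epsilon^2\leq\frac34(1+\epsilon)^2+\epsilon^2\leq1$. Helpful: $u\in V\setminus A$ adjacent to $v\in A$ is helpful for $v$ if either (a) $v=n(u)$, $w(n(u))\leq(1+\epsilon)w(u)$ and $w(N(u,A)\setminus\{n(u)\})\leq\epsilon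 w(u)$; or (b) $|N(u,A)|\geq2$, $v\in\{n(u),n_2(u)\}$, $(1+\epsilon)^{ -1}w(n(u))\leq w(n_2(u))\leq w(n(u))\leq(1+\epsilon)w(u)$ and $w(N(u,A)\setminus\{n(u),n_2(u)\})\leq\epsilon w(u)$. $u\in A^*$ and $v\in A$ are special neighbors if $v=n(u)$, $u$ is not helpful for $v$ and $\mathrm{contr}(u,v)>\frac58w(v)$. $A'$ is the set of vertices in $A\setminus A^*$ having at least one special neighbor; each $v\in A$ has at most one special neighbor, and for $v\in A'$ it is denoted $t(v)$. -}

module Defs where

open import Data.Bool using (Bool; true; false; _∧_; _∨_; if_then_else_)
open import Data.Nat using (ℕ) renaming (_≤_ to _≤ℕ_)
open import Data.Sum using (_⊎_)
open import Relation.Nullary using (¬_)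
open import Data.Fin using (Fin)
open import Data.Fin.Subset using (Subset; _∈_; _∉_; ∣_∣; ⁅_⁆; _∪_; ⊥) renaming (_-_ to _∖_)
open import Data.Vec using (tabulate; lookup; foldr)
open import Data.List using (allFin)
open import Data.Bool.ListAction using (any)
open import Data.Rational using (ℚ; 0ℚ; 1ℚ; _+_; _*_; _-_; _÷_; _⊔_; Positive; _≤_; _<_)
open import Data.Rational.Properties using (pos⇒nonZero)
open import Data.Product using (_×_; Σ; ∃)
open import Relation.Binary.PropositionalEquality using (_≡_)

record SimpleGraph (m : ℕ) : Set where
  field
    adj     : Fin m → Fin m → Bool
    irrefl  : ∀ x → adj x x ≡ false
    sym     : ∀ x y → adj x y ≡ adj y x
open SimpleGraph public

∑ : {m : ℕ} → (Fin m → ℚ) → ℚ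
∑ f = foldr _ _+_ 0ℚ (tabulate f)

wt : {m : ℕ} → (Fin m → ℚ) → Subset m → ℚ
wt w X = ∑ (λ i → if lookup X i then w i else 0ℚ)

wt² : {m : ℕ} → (Fin m → ℚ) → Subset m → ℚ
wt² w X = ∑ (λ i → if lookup X i then w i * w i else 0ℚ)

pair : {m : ℕ} → Fin m → Fin m → Subset m
pair x y = ⁅ x ⁆ ∪ ⁅ y ⁆

Independent : {m : ℕ} → SimpleGraph m → Subset m → Set
Independent G X = ∀ x y → x ∈ X → y ∈ X → adj G x y ≡ false

-- G is (k+1)-claw free: no vertex has k+1 pairwise non-adjacent neighbours
ClawFree : {m : ℕ} → ℕ → SimpleGraph m → Set
ClawFree {m} k G = ∀ v (S : Subset m) → (∀ s → s ∈ S → adj G v s ≡ true)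
               → Independent G S → ∣ S ∣ ≤ℕ k

MaxWeightIndep : {m : ℕ} → SimpleGraph m → (Fin m → ℚ) → Subset m → Set
MaxWeightIndep G w A* =
  Independent G A* × (∀ X → Independent G X → wt w X ≤ wt w A*)

N : {m : ℕ} → SimpleGraph m → Subset m → Subset m → Subset m
N {m} G X A = tabulate (λ a → lookup A a ∧
                 (lookup X a ∨ any (λ x → lookup X x ∧ adj G x a) (allFin m)))

N₁ : {m : ℕ} → SimpleGraph m → Fin m → Subset m → Subset m
N₁ G u A = N G ⁅ u ⁆ A

LocalImprovement : {m : ℕ} → SimpleGraph m → (Fin m → ℚ) → Subset m → Subset m → Set
LocalImprovement G w A X = Independent G X × wt² w (N G X A) < wt² w X

ClawShaped : {m : ℕ} → SimpleGraph m → Subset m → Subset m → Set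
ClawShaped G A X = (∣ X ∣ ≡ 1 × N G X A ≡ ⊥)
                 ⊎ (Σ _ λ v → v ∈ A × (∀ x → x ∈ X → adj G v x ≡ true))

contr : {m : ℕ} → SimpleGraph m → (w : Fin m → ℚ) → (∀ x → Positive (w x))
      → Subset m → Fin m → Fin m → ℚ
contr G w wpos A u v =
  if lookup (N₁ G u A) v
  then 0ℚ ⊔ ((w u * w u - wt² w (N₁ G u A ∖ v)) ÷ w v)
                {{pos⇒nonZero (w v) {{wpos v}}}}
  else 0ℚ

-- u (outside A) is helpful for v ∈ A, relative to the fixed choices n, n₂
-- (max-weight and second max-weight elements of N(u,A)) and the constant ε.
-- (1+ε)⁻¹ w(n(u)) ≤ w(n₂(u)) is written as w(n(u)) ≤ (1+ε) w(n₂(u)).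
Helpful : {m : ℕ} → SimpleGraph m → (Fin m → ℚ) → Subset m
        → (n n₂ : Fin m → Fin m) → ℚ → Fin m → Fin m → Set
Helpful G w A n n₂ ε u v =
  u ∉ A × v ∈ A × adj G u v ≡ true ×
  ( ( v ≡ n u
    × w (n u) ≤ (1ℚ + ε) * w u
    × wt w (N₁ G u A ∖ n u) ≤ ε * w u )
  ⊎ ( 2 ≤ℕ ∣ N₁ G u A ∣
    × (v ≡ n u ⊎ v ≡ n₂ u)
    × w (n u) ≤ (1ℚ + ε) * w (n₂ u)
    × w (n₂ u) ≤ w (n u)
    × w (n u) ≤ (1ℚ + ε) * w u
    × wt w ((N₁ G u A ∖ n u) ∖ n₂ u) ≤ ε * w u ) )

Special : {m : ℕ} → SimpleGraph m → (w : Fin m → ℚ) → (∀ x → Positive (w x))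
        → Subset m → Subset m → (n n₂ : Fin m → Fin m) → ℚ → Fin m → Fin m → Set
Special G w wpos A A* n n₂ ε u v =
  u ∈ A* × v ∈ A × v ≡ n u × ¬ Helpful G w A n n₂ ε u v
  × (+ 5 / 8) * w v < contr G w wpos A u v
  where open import Data.Integer using (+_)
        open import Data.Rational using (_/_)

InA' : {m : ℕ} → SimpleGraph m → (w : Fin m → ℚ) → (∀ x → Positive (w x))
     → Subset m → Subset m → (n n₂ : Fin m → Fin m) → ℚ → Fin m → Set
InA' G w wpos A A* n n₂ ε v =
  v ∈ A × v ∉ A* × ∃ (λ t → Special G w wpos A A* n n₂ ε t v)

IsN : {m : ℕ} → SimpleGraph m → (Fin m → ℚ) → Subset m → (Fin m → Fin m) → Set
IsN G w A n = ∀ u → (∃ λ a → a ∈ N₁ G u A) →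
  n u ∈ N₁ G u A × (∀ a → a ∈ N₁ G u A → w a ≤ w (n u))

IsN₂ : {m : ℕ} → SimpleGraph m → (Fin m → ℚ) → Subset m → (n n₂ : Fin m → Fin m) → Set
IsN₂ G w A n n₂ = ∀ u → 2 ≤ℕ ∣ N₁ G u A ∣ →
  n₂ u ∈ (N₁ G u A ∖ n u) × (∀ a → a ∈ (N₁ G u A ∖ n u) → w a ≤ w (n₂ u))

{-# OPTIONS --safe #-}
-- Write v = n(u). Since u is helpful for v only, it satisfies condition (a) of helpfulness
-- (under (b) it would be helpful for n₂(u) too): w(v) ≤ (1+ε)w(u) and w(N(u,A)∖v) ≤ εw(u),
-- hence w²(N(u,A)∖v) + ⅜w(v)² ≤ (ε² + ⅜(1+ε)²)w(u)² ≤ w(u)². As the special neighbour of v,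
-- t satisfies w²(N(t,A)∖v) + ⅝w(v)² < w(t)². Because
-- N({u,t},A) ⊆ (N(u,A)∖v) ∪ (N(t,A)∖v) ∪ {v}, adding the two bounds gives
-- w²(N({u,t},A)) < w(u)² + w(t)² = w²({u,t}), where u ≠ t since t is not helpful for v.
-- The set {u,t} ⊆ A* is independent.
module Submission where

open import Defs hiding (sym)

open import Data.Bool using (Bool; true; false; _∧_; _∨_; if_then_else_; T)
open import Data.Bool.Properties using (T-≡; T-∧; T-∨)
open import Data.Nat using (ℕ; zero; suc) renaming (_≤_ to _≤ℕ_)
open import Data.Fin using (Fin; zero; suc; _≟_)
open import Data.Fin.Properties using (suc-injective)
open import Data.Fin.Subset using (Subset; _∈_; _∉_; _⊆_; ⁅_⁆; _∪_; _─_; inside; outside) renaming (_-_ to _∖_)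
open import Data.Fin.Subset.Properties using (x∈⁅x⁆; x∈⁅y⁆⇒x≡y; x≢y⇒x∉⁅y⁆; x∈p∪q⁻; x∈p∪q⁺; x∈p∧x≢y⇒x∈p-y; p─q⊆p)
open import Data.Vec using (_∷_; lookup; there)
open import Data.Vec.Properties using (lookup-zipWith; lookup∘tabulate; []=⇒lookup; lookup⇒[]=)
open import Data.List using (allFin)
open import Data.List.Membership.Propositional using (lose)
open import Data.List.Membership.Propositional.Properties using (∈-allFin)
open import Data.List.Relation.Unary.Any using (satisfied)
open import Data.List.Relation.Unary.Any.Properties using (any⁺; any⁻)
open import Data.Bool.ListAction using (any)
open import Data.Integer using (+_)
open import Data.Rational using (ℚ; 0ℚ; 1ℚ; _+_; _*_; _-_; _÷_; _⊔_; _/_; 1/_; Positive; _≤_; _<_; nonNegative)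
open import Data.Rational.Properties hiding (_≟_)
open import Data.Rational.Solver using (module +-*-Solver)
open import Data.Product using (_×_; _,_; ∃-syntax; proj₁; proj₂)
open import Data.Sum using (_⊎_; inj₁; inj₂)
import Data.Sum as Sum
open import Data.Empty using (⊥-elim)
open import Function using (_∘_)
open import Function.Bundles using (Equivalence)
open import Relation.Nullary using (¬_; yes; no)
open import Relation.Binary.PropositionalEquality using (_≡_; _≢_; refl; sym; trans; cong; cong₂; subst)

open Equivalence using (to; from)
open +-*-Solver
open ≤-Reasoning

private variable
  m : ℕ

p≤p+q : ∀ {p q} → 0ℚ ≤ q → p ≤ p + q
p≤p+q {p} {q} 0≤q = subst (_≤ p + q) (+-identityʳ p) (+-monoʳ-≤ p 0≤q)

*-nonNeg : ∀ {p q} → 0ℚ ≤ p → 0ℚ ≤ q → 0ℚ ≤ p * q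
*-nonNeg {p} {q} 0≤p 0≤q =
  nonNegative⁻¹ (p * q) {{nonNeg*nonNeg⇒nonNeg p {{nonNegative 0≤p}} q {{nonNegative 0≤q}}}}

*-self-mono-≤ : ∀ {p q} → 0ℚ ≤ p → p ≤ q → p * p ≤ q * q
*-self-mono-≤ {p} {q} 0≤p p≤q =
  ≤-trans (*-monoˡ-≤-nonNeg p {{nonNegative 0≤p}} p≤q)
          (*-monoʳ-≤-nonNeg q {{nonNegative (≤-trans 0≤p p≤q)}} p≤q)

÷-*-cancel : ∀ p q .{{_ : Positive q}} → (p ÷ q) {{pos⇒nonZero q}} * q ≡ p
÷-*-cancel p q = begin-equality
  p * 1/ q * q     ≡⟨ *-assoc p (1/ q) q ⟩
  p * (1/ q * q)   ≡⟨ cong (p *_) (*-inverseˡ q) ⟩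
  p * 1ℚ           ≡⟨ *-identityʳ p ⟩
  p                ∎
  where instance _ = pos⇒nonZero q

<-÷⇒*< : ∀ {p q r} .{{_ : Positive r}} → p < (q ÷ r) {{pos⇒nonZero r}} → p * r < q
<-÷⇒*< {p} {q} {r} p<q÷r = subst (p * r <_) (÷-*-cancel q r) (*-monoˡ-<-pos r p<q÷r)

<-if-0⊔⇒< : ∀ b {p q} → 0ℚ < p → p < (if b then 0ℚ ⊔ q else 0ℚ) → p < q
<-if-0⊔⇒< false 0<p p<0 = ⊥-elim (<-asym 0<p p<0)
<-if-0⊔⇒< true {p} {q} 0<p p<0⊔q with ⊔-sel 0ℚ q
... | inj₁ 0⊔q≡0 = ⊥-elim (<-asym 0<p (subst (p <_) 0⊔q≡0 p<0⊔q))
... | inj₂ 0⊔q≡q = subst (p <_) 0⊔q≡q p<0⊔q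

∑-mono-≤ : {f g : Fin m → ℚ} → (∀ i → f i ≤ g i) → ∑ f ≤ ∑ g
∑-mono-≤ {zero}  f≤g = ≤-refl
∑-mono-≤ {suc m} f≤g = +-mono-≤ (f≤g zero) (∑-mono-≤ (f≤g ∘ suc))

∑-nonNeg : {f : Fin m → ℚ} → (∀ i → 0ℚ ≤ f i) → 0ℚ ≤ ∑ f
∑-nonNeg {zero}  f≥0 = ≤-refl
∑-nonNeg {suc m} f≥0 = +-mono-≤ (f≥0 zero) (∑-nonNeg (f≥0 ∘ suc))

∑-zero : (f : Fin m → ℚ) → (∀ i → f i ≡ 0ℚ) → ∑ f ≡ 0ℚ
∑-zero {zero}  f f≡0 = refl
∑-zero {suc m} f f≡0 = cong₂ _+_ (f≡0 zero) (∑-zero (f ∘ suc) (f≡0 ∘ suc))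

∑-cong : {f g : Fin m → ℚ} → (∀ i → f i ≡ g i) → ∑ f ≡ ∑ g
∑-cong {zero}  f≡g = refl
∑-cong {suc m} f≡g = cong₂ _+_ (f≡g zero) (∑-cong (f≡g ∘ suc))

∑-single : (f : Fin m → ℚ) (x : Fin m) → (∀ i → i ≢ x → f i ≡ 0ℚ) → ∑ f ≡ f x
∑-single f zero    f≡0 =
  trans (cong (λ z → f zero + z) (∑-zero (f ∘ suc) (λ i → f≡0 (suc i) λ ()))) (+-identityʳ (f zero))
∑-single f (suc x) f≡0 =
  trans (cong₂ _+_ (f≡0 zero λ ()) (∑-single (f ∘ suc) x (λ i i≢x → f≡0 (suc i) (i≢x ∘ suc-injective))))
        (+-identityˡ (f (suc x)))

∑-distrib-+ : (f g : Fin m → ℚ) → ∑ (λ i → f i + g i) ≡ ∑ f + ∑ g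
∑-distrib-+ {zero}  f g = refl
∑-distrib-+ {suc m} f g = begin-equality
  (f zero + g zero) + ∑ (λ i → f (suc i) + g (suc i))
    ≡⟨ cong (λ z → f zero + g zero + z) (∑-distrib-+ (f ∘ suc) (g ∘ suc)) ⟩
  (f zero + g zero) + (∑ (f ∘ suc) + ∑ (g ∘ suc))
    ≡⟨ solve 4 (λ a b c d → (a :+ b) :+ (c :+ d) := (a :+ c) :+ (b :+ d)) refl
         (f zero) (g zero) (∑ (f ∘ suc)) (∑ (g ∘ suc)) ⟩
  (f zero + ∑ (f ∘ suc)) + (g zero + ∑ (g ∘ suc))
    ∎

∑-squares-≤-square-∑ : {f : Fin m → ℚ} → (∀ i → 0ℚ ≤ f i) → ∑ (λ i → f i * f i) ≤ ∑ f * ∑ f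
∑-squares-≤-square-∑ {zero}      _   = ≤-refl
∑-squares-≤-square-∑ {suc m} {f} f≥0 = begin
  a * a + ∑ (λ i → f (suc i) * f (suc i))  ≤⟨ +-monoʳ-≤ (a * a) (∑-squares-≤-square-∑ (f≥0 ∘ suc)) ⟩
  a * a + s * s                            ≤⟨ p≤p+q (+-mono-≤ 0≤as 0≤as) ⟩
  (a * a + s * s) + (a * s + a * s)        ≡⟨ solve 2 (λ a s → (a :* a :+ s :* s) :+ (a :* s :+ a :* s)
                                                         := (a :+ s) :* (a :+ s)) refl a s ⟩
  (a + s) * (a + s)                        ∎
  where
  a = f zero
  s = ∑ (f ∘ suc)
  0≤as : 0ℚ ≤ a * s
  0≤as = *-nonNeg (f≥0 zero) (∑-nonNeg (f≥0 ∘ suc))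

-- wt f S ≡ ∑ (restrict f S) and wt² w S ≡ wt (λ i → w i * w i) S hold by definition,
-- so the lemmas on wt below also apply to wt².
restrict : (Fin m → ℚ) → Subset m → Fin m → ℚ
restrict f S i = if lookup S i then f i else 0ℚ

restrict-nonNeg : {f : Fin m → ℚ} → (∀ i → 0ℚ ≤ f i) → (S : Subset m) (i : Fin m) → 0ℚ ≤ restrict f S i
restrict-nonNeg f≥0 S i with lookup S i
... | true  = f≥0 i
... | false = ≤-refl

restrict-∈ : (f : Fin m → ℚ) {S : Subset m} {i : Fin m} → i ∈ S → restrict f S i ≡ f i
restrict-∈ f i∈S rewrite []=⇒lookup i∈S = refl

restrict-∉ : (f : Fin m → ℚ) {S : Subset m} {i : Fin m} → i ∉ S → restrict f S i ≡ 0ℚ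
restrict-∉ f {S} {i} i∉S with lookup S i in i∈S
... | true  = ⊥-elim (i∉S (lookup⇒[]= i S i∈S))
... | false = refl

lookup-∪ : (S T : Subset m) (i : Fin m) → lookup (S ∪ T) i ≡ lookup S i ∨ lookup T i
lookup-∪ S T i = lookup-zipWith _∨_ i S T

x∈p─q⇒x∉q : ∀ {p q : Subset m} {x} → x ∈ p ─ q → x ∉ q
x∈p─q⇒x∉q {p = _ ∷ _} {inside  ∷ _} {zero}  ()          _
x∈p─q⇒x∉q {p = _ ∷ _} {outside ∷ _} {zero}  _           ()
x∈p─q⇒x∉q {p = _ ∷ _} {_ ∷ _}       {suc x} (there x∈)  (there x∈q) = x∈p─q⇒x∉q x∈ x∈q

p∪q⊆p-x∪q-x∪⁅x⁆ : (S T : Subset m) (v : Fin m) → S ∪ T ⊆ ((S ∖ v) ∪ (T ∖ v)) ∪ ⁅ v ⁆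
p∪q⊆p-x∪q-x∪⁅x⁆ S T v {x} x∈S∪T with x ≟ v
... | yes refl = x∈p∪q⁺ (inj₂ (x∈⁅x⁆ x))
... | no  x≢v  = x∈p∪q⁺ (inj₁ (x∈p∪q⁺ (Sum.map (λ x∈S → x∈p∧x≢y⇒x∈p-y x∈S x≢v)
                                                (λ x∈T → x∈p∧x≢y⇒x∈p-y x∈T x≢v)
                                                (x∈p∪q⁻ S T x∈S∪T))))

wt-nonNeg : {f : Fin m → ℚ} → (∀ i → 0ℚ ≤ f i) → (S : Subset m) → 0ℚ ≤ wt f S
wt-nonNeg f≥0 S = ∑-nonNeg (restrict-nonNeg f≥0 S)

wt-mono-⊆ : {f : Fin m → ℚ} {S T : Subset m} → (∀ i → 0ℚ ≤ f i) → S ⊆ T → wt f S ≤ wt f T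
wt-mono-⊆ {f = f} {S} {T} f≥0 S⊆T = ∑-mono-≤ pointwise
  where
  pointwise : ∀ i → restrict f S i ≤ restrict f T i
  pointwise i with lookup S i in i∈S
  ... | true  = ≤-reflexive (sym (restrict-∈ f (S⊆T (lookup⇒[]= i S i∈S))))
  ... | false = restrict-nonNeg f≥0 T i

wt-∪-≤ : {f : Fin m → ℚ} → (∀ i → 0ℚ ≤ f i) → (S T : Subset m) → wt f (S ∪ T) ≤ wt f S + wt f T
wt-∪-≤ {f = f} f≥0 S T = ≤-trans (∑-mono-≤ pointwise) (≤-reflexive (∑-distrib-+ (restrict f S) (restrict f T)))
  where
  pointwise : ∀ i → restrict f (S ∪ T) i ≤ restrict f S i + restrict f T i
  pointwise i rewrite lookup-∪ S T i with lookup S i | lookup T i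
  ... | true  | true  = p≤p+q (f≥0 i)
  ... | true  | false = ≤-reflexive (sym (+-identityʳ (f i)))
  ... | false | _     = ≤-reflexive (sym (+-identityˡ _))

wt-∪-disjoint : (f : Fin m → ℚ) (S T : Subset m) → (∀ i → i ∈ S → i ∉ T)
              → wt f (S ∪ T) ≡ wt f S + wt f T
wt-∪-disjoint f S T disjoint = trans (∑-cong pointwise) (∑-distrib-+ (restrict f S) (restrict f T))
  where
  pointwise : ∀ i → restrict f (S ∪ T) i ≡ restrict f S i + restrict f T i
  pointwise i rewrite lookup-∪ S T i with lookup S i in i∈S | lookup T i in i∈T
  ... | true  | true  = ⊥-elim (disjoint i (lookup⇒[]= i S i∈S) (lookup⇒[]= i T i∈T))
  ... | true  | false = sym (+-identityʳ (f i))
  ... | false | _     = sym (+-identityˡ _)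

wt-⁅⁆ : (f : Fin m → ℚ) (x : Fin m) → wt f ⁅ x ⁆ ≡ f x
wt-⁅⁆ f x = trans (∑-single (restrict f ⁅ x ⁆) x (λ i i≢x → restrict-∉ f (x≢y⇒x∉⁅y⁆ i≢x)))
                  (restrict-∈ f (x∈⁅x⁆ x))

wt-pair : (f : Fin m → ℚ) {x y : Fin m} → x ≢ y → wt f (pair x y) ≡ f x + f y
wt-pair f {x} {y} x≢y = trans (wt-∪-disjoint f ⁅ x ⁆ ⁅ y ⁆ disjoint) (cong₂ _+_ (wt-⁅⁆ f x) (wt-⁅⁆ f y))
  where
  disjoint : ∀ i → i ∈ ⁅ x ⁆ → i ∉ ⁅ y ⁆
  disjoint i i∈⁅x⁆ i∈⁅y⁆ = x≢y (trans (sym (x∈⁅y⁆⇒x≡y x i∈⁅x⁆)) (x∈⁅y⁆⇒x≡y y i∈⁅y⁆))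

wt²≤wt*wt : {w : Fin m → ℚ} → (∀ i → 0ℚ ≤ w i) → (S : Subset m) → wt² w S ≤ wt w S * wt w S
wt²≤wt*wt {w = w} w≥0 S =
  ≤-trans (≤-reflexive (∑-cong restrict-square)) (∑-squares-≤-square-∑ (restrict-nonNeg w≥0 S))
  where
  restrict-square : ∀ i → restrict (λ j → w j * w j) S i ≡ restrict w S i * restrict w S i
  restrict-square i with lookup S i
  ... | true  = refl
  ... | false = refl

Touches : SimpleGraph m → Subset m → Fin m → Set
Touches G X a = a ∈ X ⊎ ∃[ x ] (x ∈ X × adj G x a ≡ true)

module _ {G : SimpleGraph m} {X A : Subset m} {a : Fin m} where

  private
    T⇒∈ : ∀ {S : Subset m} {i} → T (lookup S i) → i ∈ S
    T⇒∈ {S} {i} t = lookup⇒[]= i S (T-≡ .to t)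

    ∈⇒T : ∀ {S : Subset m} {i} → i ∈ S → T (lookup S i)
    ∈⇒T i∈S = T-≡ .from ([]=⇒lookup i∈S)

    edgeFrom : Fin m → Bool
    edgeFrom x = lookup X x ∧ adj G x a

    lookup-N : lookup (N G X A) a ≡ lookup A a ∧ (lookup X a ∨ any edgeFrom (allFin m))
    lookup-N = lookup∘tabulate _ a

  ∈N⁻ : a ∈ N G X A → a ∈ A × Touches G X a
  ∈N⁻ a∈N with T-∧ .to (subst T lookup-N (∈⇒T a∈N))
  ... | a∈A , touches = T⇒∈ a∈A , Sum.map T⇒∈ viaEdge (T-∨ .to touches)
    where
    viaEdge : T (any edgeFrom (allFin m)) → ∃[ x ] (x ∈ X × adj G x a ≡ true)
    viaEdge t with x , edge ← satisfied (any⁻ edgeFrom (allFin m) t) =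
      x , T⇒∈ (proj₁ (T-∧ .to edge)) , T-≡ .to (proj₂ (T-∧ .to edge))

  ∈N⁺ : a ∈ A → Touches G X a → a ∈ N G X A
  ∈N⁺ a∈A touches =
    T⇒∈ (subst T (sym lookup-N) (T-∧ .from (∈⇒T a∈A , T-∨ .from (Sum.map ∈⇒T viaEdge touches))))
    where
    viaEdge : ∃[ x ] (x ∈ X × adj G x a ≡ true) → T (any edgeFrom (allFin m))
    viaEdge (x , x∈X , edge) = any⁺ edgeFrom (lose (∈-allFin x) (T-∧ .from (∈⇒T x∈X , T-≡ .from edge)))

Touches-∪⁻ : ∀ {G : SimpleGraph m} X Y {a} → Touches G (X ∪ Y) a → Touches G X a ⊎ Touches G Y a
Touches-∪⁻ X Y (inj₁ a∈X∪Y)            = Sum.map inj₁ inj₁ (x∈p∪q⁻ X Y a∈X∪Y)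
Touches-∪⁻ X Y (inj₂ (x , x∈X∪Y , xa)) = Sum.map (λ x∈X → inj₂ (x , x∈X , xa)) (λ x∈Y → inj₂ (x , x∈Y , xa))
                                                  (x∈p∪q⁻ X Y x∈X∪Y)

N-∪-⊆ : ∀ {G : SimpleGraph m} X Y A → N G (X ∪ Y) A ⊆ N G X A ∪ N G Y A
N-∪-⊆ {G = G} X Y A a∈N with a∈A , touches ← ∈N⁻ {G = G} {X ∪ Y} {A} a∈N =
  x∈p∪q⁺ (Sum.map (∈N⁺ {G = G} a∈A) (∈N⁺ {G = G} a∈A) (Touches-∪⁻ {G = G} X Y touches))

∈N₁⁻ : ∀ {G : SimpleGraph m} {u A a} → u ∉ A → a ∈ N₁ G u A → a ∈ A × adj G u a ≡ true
∈N₁⁻ {G = G} {u} {A} u∉A a∈N with ∈N⁻ {G = G} {⁅ u ⁆} {A} a∈N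
... | a∈A , inj₁ a∈⁅u⁆ with refl ← x∈⁅y⁆⇒x≡y u a∈⁅u⁆ = ⊥-elim (u∉A a∈A)
... | a∈A , inj₂ (x , x∈⁅u⁆ , ua) with refl ← x∈⁅y⁆⇒x≡y u x∈⁅u⁆ = a∈A , ua

Independent-⊆ : ∀ (G : SimpleGraph m) {X Y} → X ⊆ Y → Independent G Y → Independent G X
Independent-⊆ G X⊆Y Y-indep x y x∈X y∈X = Y-indep x y (X⊆Y x∈X) (X⊆Y y∈X)

pair⊆ : ∀ {S : Subset m} {x y} → x ∈ S → y ∈ S → pair x y ⊆ S
pair⊆ {x = x} {y} x∈S y∈S i∈pair with x∈p∪q⁻ ⁅ x ⁆ ⁅ y ⁆ i∈pair
... | inj₁ i∈⁅x⁆ rewrite x∈⁅y⁆⇒x≡y x i∈⁅x⁆ = x∈S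
... | inj₂ i∈⁅y⁆ rewrite x∈⁅y⁆⇒x≡y y i∈⁅y⁆ = y∈S

wt²-N-pair-≤ : (G : SimpleGraph m) {w : Fin m → ℚ} → (∀ i → 0ℚ ≤ w i) → (A : Subset m) (u t v : Fin m)
             → wt² w (N G (pair u t) A) ≤ (wt² w (N₁ G u A ∖ v) + wt² w (N₁ G t A ∖ v)) + w v * w v
wt²-N-pair-≤ G {w} w≥0 A u t v = begin
  wt² w (N G (pair u t) A)                       ≤⟨ wt-mono-⊆ w²≥0 (λ a∈N → p∪q⊆p-x∪q-x∪⁅x⁆ Nu Nt v (N-∪-⊆ {G = G} ⁅ u ⁆ ⁅ t ⁆ A a∈N)) ⟩
  wt² w (((Nu ∖ v) ∪ (Nt ∖ v)) ∪ ⁅ v ⁆)             ≤⟨ wt-∪-≤ w²≥0 ((Nu ∖ v) ∪ (Nt ∖ v)) ⁅ v ⁆ ⟩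
  wt² w ((Nu ∖ v) ∪ (Nt ∖ v)) + wt² w ⁅ v ⁆         ≤⟨ +-mono-≤ (wt-∪-≤ w²≥0 (Nu ∖ v) (Nt ∖ v)) (≤-reflexive (wt-⁅⁆ _ v)) ⟩
  (wt² w (Nu ∖ v) + wt² w (Nt ∖ v)) + w v * w v ∎
  where
  Nu = N₁ G u A
  Nt = N₁ G t A
  w²≥0 : ∀ i → 0ℚ ≤ w i * w i
  w²≥0 i = *-nonNeg (w≥0 i) (w≥0 i)

soleHelpful⇒conditionA : ∀ {G : SimpleGraph m} {w A n n₂ ε u} → IsN₂ G w A n n₂ → u ∉ A
  → (∀ v → Helpful G w A n n₂ ε u v → v ≡ n u) → Helpful G w A n n₂ ε u (n u)
  → w (n u) ≤ (1ℚ + ε) * w u × wt w (N₁ G u A ∖ n u) ≤ ε * w u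
soleHelpful⇒conditionA _ _ _ (_ , _ , _ , inj₁ (_ , conditionA)) = conditionA
soleHelpful⇒conditionA {G = G} {n = n} {n₂} {u = u} isN₂ u∉A onlyN (_ , _ , _ , inj₂ (two , _ , conditionB)) =
  ⊥-elim (x∈p─q⇒x∉q n₂∈N∖n (subst (_∈ ⁅ n u ⁆) (sym (onlyN (n₂ u) n₂-helpful)) (x∈⁅x⁆ (n u))))
  where
  n₂∈N∖n = proj₁ (isN₂ u two)
  n₂-neighbour = ∈N₁⁻ {G = G} u∉A (p─q⊆p _ _ n₂∈N∖n)
  n₂-helpful = u∉A , proj₁ n₂-neighbour , proj₂ n₂-neighbour , inj₂ (two , inj₂ refl , conditionB)

special⇒gain : ∀ {G : SimpleGraph m} {w wpos A A* n n₂ ε t v} → Special G w wpos A A* n n₂ ε t v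
             → (+ 5 / 8) * (w v * w v) < w t * w t - wt² w (N₁ G t A ∖ v)
special⇒gain {G = G} {w} {wpos} {A} {t = t} {v} (_ , _ , _ , _ , contr>) =
  subst (_< w t * w t - wt² w (N₁ G t A ∖ v)) (*-assoc (+ 5 / 8) (w v) (w v))
        (<-÷⇒*< {{wpos v}} (<-if-0⊔⇒< (lookup (N₁ G t A) v) 0<5/8v contr>))
  where
  0<5/8v : 0ℚ < (+ 5 / 8) * w v
  0<5/8v = positive⁻¹ _ {{pos*pos⇒pos (+ 5 / 8) (w v) {{wpos v}}}}

conditionA-budget : {w : Fin m → ℚ} → (∀ i → 0ℚ ≤ w i) → ∀ ε {u v} (S : Subset m)
  → w v ≤ (1ℚ + ε) * w u → wt w S ≤ ε * w u
  → (+ 3 / 8) * ((1ℚ + ε) * (1ℚ + ε)) + ε * ε ≤ 1ℚ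
  → wt² w S + (+ 3 / 8) * (w v * w v) ≤ w u * w u
conditionA-budget {w = w} w≥0 ε {u} {v} S v≤ S≤ budget = begin
  wt² w S + (+ 3 / 8) * (w v * w v)
    ≤⟨ +-mono-≤ (≤-trans (wt²≤wt*wt w≥0 S) (*-self-mono-≤ (wt-nonNeg w≥0 S) S≤))
                (*-monoˡ-≤-nonNeg (+ 3 / 8) (*-self-mono-≤ (w≥0 v) v≤)) ⟩
  (ε * w u) * (ε * w u) + (+ 3 / 8) * (((1ℚ + ε) * w u) * ((1ℚ + ε) * w u))
    ≡⟨ solve 4 (λ c e x o → (e :* x) :* (e :* x) :+ c :* (((o :+ e) :* x) :* ((o :+ e) :* x))
                            := (c :* ((o :+ e) :* (o :+ e)) :+ e :* e) :* (x :* x)) refl (+ 3 / 8) ε (w u) 1ℚ ⟩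
  ((+ 3 / 8) * ((1ℚ + ε) * (1ℚ + ε)) + ε * ε) * (w u * w u)
    ≤⟨ *-monoʳ-≤-nonNeg (w u * w u) {{nonNegative (*-nonNeg (w≥0 u) (w≥0 u))}} budget ⟩
  1ℚ * (w u * w u)
    ≡⟨ *-identityˡ (w u * w u) ⟩
  w u * w u ∎

-- ⅜ + ⅝ = 1: the square of the shared neighbour v is paid for partly by u and partly by t.
split-gain : ∀ a b V {U T} → a + (+ 3 / 8) * V ≤ U → (+ 5 / 8) * V < T - b → (a + b) + V < U + T
split-gain a b V {U} {T} u-pays t-pays = begin-strict
  (a + b) + V
    ≡⟨ solve 3 (λ a b V → (a :+ b) :+ V := (a :+ con (+ 3 / 8) :* V) :+ (b :+ con (+ 5 / 8) :* V)) refl a b V ⟩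
  (a + (+ 3 / 8) * V) + (b + (+ 5 / 8) * V)
    <⟨ +-mono-≤-< u-pays (+-monoʳ-< b t-pays) ⟩
  U + (b + (T - b))
    ≡⟨ cong (λ z → U + z) (solve 2 (λ b T → b :+ (T :- b) := T) refl b T) ⟩
  U + T ∎

lemma14 : (k : ℕ) → 4 ≤ℕ k → {m : ℕ} (G : SimpleGraph m) → ClawFree k G
    → (w : Fin m → ℚ) (wpos : ∀ x → Positive (w x))
    → (A* A : Subset m) → MaxWeightIndep G w A* → Independent G A
    → (∀ X → Independent G X → ClawShaped G A X → ¬ LocalImprovement G w A X)
    → (n n₂ : Fin m → Fin m) → IsN G w A n → IsN₂ G w A n n₂
    → (ε : ℚ) → 0ℚ < ε
    → (+ 3 / 8) * ((1ℚ + ε) * (1ℚ + ε)) + ε * ε ≤ (+ 11 / 16) * ((1ℚ + ε) * (1ℚ + ε)) + ε * ε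
    → (+ 11 / 16) * ((1ℚ + ε) * (1ℚ + ε)) + ε * ε ≤ (+ 3 / 4) * ((1ℚ + ε) * (1ℚ + ε)) + ε * ε
    → (+ 3 / 4) * ((1ℚ + ε) * (1ℚ + ε)) + ε * ε ≤ 1ℚ
    → (u : Fin m) → u ∈ A* → u ∉ A
    → (∀ v → (Helpful G w A n n₂ ε u v → v ≡ n u) × (v ≡ n u → Helpful G w A n n₂ ε u v))
    → InA' G w wpos A A* n n₂ ε (n u)
    → ∀ t → Special G w wpos A A* n n₂ ε t (n u)
    → LocalImprovement G w A (pair u t)
lemma14 _ _ G _ w wpos A* A (A*-indep , _) _ _ n n₂ _ isN₂ ε _ b₁ b₂ b₃ u u∈A* u∉A helpfulExactlyFor-n _ t special =
  Independent-⊆ G (pair⊆ u∈A* (proj₁ special)) A*-indep , improvement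
  where
  v = n u
  w≥0 : ∀ i → 0ℚ ≤ w i
  w≥0 i = <⇒≤ (positive⁻¹ (w i) {{wpos i}})
  u-helpful = proj₂ (helpfulExactlyFor-n v) refl
  conditionA = soleHelpful⇒conditionA {G = G} {ε = ε} isN₂ u∉A (proj₁ ∘ helpfulExactlyFor-n) u-helpful
  u≢t : u ≢ t
  u≢t refl = proj₁ (proj₂ (proj₂ (proj₂ special))) u-helpful
  u-pays : wt² w (N₁ G u A ∖ v) + (+ 3 / 8) * (w v * w v) ≤ w u * w u
  u-pays = conditionA-budget w≥0 ε (N₁ G u A ∖ v) (proj₁ conditionA) (proj₂ conditionA) (≤-trans b₁ (≤-trans b₂ b₃))
  t-pays : (+ 5 / 8) * (w v * w v) < w t * w t - wt² w (N₁ G t A ∖ v)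
  t-pays = special⇒gain {G = G} {w} {wpos} {A} {A*} {n} {n₂} {ε} special
  improvement : wt² w (N G (pair u t) A) < wt² w (pair u t)
  improvement = begin-strict
    wt² w (N G (pair u t) A)   ≤⟨ wt²-N-pair-≤ G w≥0 A u t v ⟩
    (a + b) + w v * w v        <⟨ split-gain a b (w v * w v) u-pays t-pays ⟩
    w u * w u + w t * w t      ≡⟨ wt-pair (λ i → w i * w i) u≢t ⟨
    wt² w (pair u t)           ∎
    where
    a = wt² w (N₁ G u A ∖ v)
    b = wt² w (N₁ G t A ∖ v)
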